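{- Let $\ell>4$ be an even integer and let $k>2$ be the smallest integer greater than $2$ that does not divide $\ell$. Then there exists an oriented graph $G$ on $n=\lfloor\frac{k-1}{2}\rfloor(\ell-2)+1$ vertices with minimum semidegree $\delta^0(G)\ge\lfloor n/k\rfloor+1$ that contains no directed cycle of length greater than $\ell-1$ (in particular, no directed cycle of length $\ell$).
   Context: An oriented graph is a directed graph obtained from a simple undirected graph by orienting each edge. The minimum semidegree $\delta^0(G)$ is the minimum of the minimum outdegree and minimum indegree of $G$. -}

module Defs where

open import Data.Nat using (ℕ; zero; suc; _+_; _*_; _∸_; _≤_; _<_; NonZero; >-nonZero)
open import Data.Nat.DivMod using (_/_)
open import Data.Nat.Properties using (<-trans)
open import Data.Bool using (Bool; true; false)
open import Data.Fin using (Fin; zero; suc; inject₁; fromℕ)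
open import Data.List using (List; map; allFin)
open import Data.Nat.ListAction using (sum)
open import Data.Empty using (⊥)
open import Data.Product using (_×_)
open import Relation.Binary.PropositionalEquality using (_≡_)

Digraph : ℕ → Set
Digraph n = Fin n → Fin n → Bool

Oriented : ∀ {n} → Digraph n → Set
Oriented {n} G = ((u : Fin n) → G u u ≡ false)
               × ((u v : Fin n) → G u v ≡ true → G v u ≡ false)

bit : Bool → ℕ
bit true  = 1
bit false = 0

outdeg : ∀ {n} → Digraph n → Fin n → ℕ
outdeg {n} G v = sum (map (λ u → bit (G v u)) (allFin n))

indeg : ∀ {n} → Digraph n → Fin n → ℕ
indeg {n} G v = sum (map (λ u → bit (G u v)) (allFin n))

MinSemidegreeAtLeast : ∀ {n} → Digraph n → ℕ → Set
MinSemidegreeAtLeast {n} G d = (v : Fin n) → (d ≤ outdeg G v) × (d ≤ indeg G v)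

record DirCycle' {n} (G : Digraph n) (m : ℕ) : Set where
  field
    vtx   : Fin (suc m) → Fin n
    inj   : (i j : Fin (suc m)) → vtx i ≡ vtx j → i ≡ j
    step  : (i : Fin m) → G (vtx (inject₁ i)) (vtx (suc i)) ≡ true
    close : G (vtx (fromℕ m)) (vtx zero) ≡ true

DirCycle : ∀ {n} → Digraph n → ℕ → Set
DirCycle G zero    = ⊥
DirCycle G (suc m) = DirCycle' G m

divFloor : ℕ → (k : ℕ) → 0 < k → ℕ
divFloor a k p = _/_ a k {{ >-nonZero p }}

-- Write ℓ = 2h + 2 and take m = ⌊(k-1)/2⌋ copies of a regular tournament on
-- 2h + 1 vertices, all sharing one vertex (the hub).  Every vertex then has in-
-- and outdegree at least h, and h > ⌊n/k⌋ because n = 2hm + 1 ≤ (k-1)h + 1 < kh.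
-- A cycle passes through the hub at most once, and the copies meet only in the
-- hub, so every cycle lies inside one copy and has at most 2h + 1 < ℓ vertices.
module Submission where

open import Defs
open import Data.Nat
open import Data.Nat.Properties
open import Data.Nat.DivMod
open import Data.Nat.Divisibility using (_∣_; divides)
open import Data.Nat.ListAction using (sum)
open import Algebra.Properties.CommutativeSemigroup +-commutativeSemigroup using (xy∙z≈xz∙y)
open import Data.Bool using (true)
open import Data.Fin as Fin using (Fin; toℕ; fromℕ<; inject₁; fromℕ)
open import Data.Fin.Properties
  using (toℕ-injective; toℕ-fromℕ<; fromℕ<-toℕ; fromℕ<-injective; toℕ-inject₁; toℕ-fromℕ; toℕ<n; pigeonhole; any?)
open import Data.List using (map; allFin; tabulate)
open import Data.List.Properties using (map-tabulate)
open import Data.Empty using (⊥; ⊥-elim)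
open import Data.Product using (Σ; ∃; _×_; _,_; proj₁; proj₂)
open import Data.Sum using (_⊎_; inj₁; inj₂)
open import Function using (_∘_; id)
open import Relation.Nullary using (¬_; Dec; yes; no; does)
open import Relation.Nullary.Decidable using (dec-true; dec-false; _×-dec_; _⊎-dec_)
open import Relation.Binary.PropositionalEquality

sumBelow : ℕ → (ℕ → ℕ) → ℕ
sumBelow zero    f = 0
sumBelow (suc n) f = sumBelow n f + f n

sumBelow-suc : ∀ n f → sumBelow (suc n) f ≡ f 0 + sumBelow n (f ∘ suc)
sumBelow-suc zero    f = +-comm 0 (f 0)
sumBelow-suc (suc n) f = begin
  sumBelow (suc n) f + f (suc n)           ≡⟨ cong (_+ f (suc n)) (sumBelow-suc n f) ⟩
  f 0 + sumBelow n (f ∘ suc) + f (suc n)   ≡⟨ +-assoc (f 0) _ _ ⟩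
  f 0 + sumBelow (suc n) (f ∘ suc)         ∎
  where open ≡-Reasoning

sum-tabulate : ∀ n f → sum (tabulate {n = n} (f ∘ toℕ)) ≡ sumBelow n f
sum-tabulate zero    f = refl
sum-tabulate (suc n) f = trans (cong (f 0 +_) (sum-tabulate n (f ∘ suc))) (sym (sumBelow-suc n f))

sum-allFin : ∀ n f → sum (map (f ∘ toℕ) (allFin n)) ≡ sumBelow n f
sum-allFin n f = trans (cong sum (map-tabulate {n = n} id (f ∘ toℕ))) (sum-tabulate n f)

sumBelow-mono : ∀ f {a c} → a ≤ c → sumBelow a f ≤ sumBelow c f
sumBelow-mono f {a} {zero}  z≤n = ≤-refl
sumBelow-mono f {a} {suc c} a≤c with m≤n⇒m<n∨m≡n a≤c
... | inj₂ refl        = ≤-refl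
... | inj₁ (s≤s a≤c') = ≤-trans (sumBelow-mono f a≤c') (m≤m+n _ _)

sumBelow-run : ∀ f a l → (∀ j → j < l → 1 ≤ f (a + j)) → sumBelow a f + l ≤ sumBelow (a + l) f
sumBelow-run f a zero    _   = ≤-reflexive (trans (+-identityʳ _) (cong (λ c → sumBelow c f) (sym (+-identityʳ a))))
sumBelow-run f a (suc l) run = begin
  sumBelow a f + suc l            ≡⟨ trans (+-suc _ l) (+-comm 1 _) ⟩
  sumBelow a f + l + 1            ≤⟨ +-mono-≤ (sumBelow-run f a l (λ j j<l → run j (m<n⇒m<1+n j<l))) (run l ≤-refl) ⟩
  sumBelow (suc (a + l)) f        ≡⟨ cong (λ c → sumBelow c f) (sym (+-suc a l)) ⟩
  sumBelow (a + suc l) f          ∎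
  where open ≤-Reasoning

minSemidegree-mono : ∀ {n} {G : Digraph n} {d d′} → d ≤ d′ → MinSemidegreeAtLeast G d′ → MinSemidegreeAtLeast G d
minSemidegree-mono d≤d′ δ v = ≤-trans d≤d′ (proj₁ (δ v)) , ≤-trans d≤d′ (proj₂ (δ v))

-- Vertex 0 is the hub and vertex suc (r + b * B) is position r < B = 2h of block b.
-- Within a block r points to r + 1, …, r + h taken cyclically modulo B, except
-- that the arc between r and r + h always goes from the lower half [0, h) to the
-- upper half; the lower half receives arcs from the hub, the upper half sends arcs to it.
module HubGluedTournaments (t : ℕ) where

  h B : ℕ
  h = suc t
  B = h + h

  InBlock : ℕ → ℕ → Set
  InBlock r s = (r < s × s ≤ r + h) ⊎ s + h < r

  Arc : ℕ → ℕ → Set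
  Arc zero    zero    = ⊥
  Arc zero    (suc y) = y % B < h
  Arc (suc x) zero    = h ≤ x % B
  Arc (suc x) (suc y) = x / B ≡ y / B × InBlock (x % B) (y % B)

  Arc? : ∀ x y → Dec (Arc x y)
  Arc? zero    zero    = no λ ()
  Arc? zero    (suc y) = y % B <? h
  Arc? (suc x) zero    = h ≤? x % B
  Arc? (suc x) (suc y) = (x / B ≟ y / B) ×-dec ((x % B <? y % B ×-dec y % B ≤? x % B + h) ⊎-dec y % B + h <? x % B)

  graph : ∀ n → Digraph n
  graph n u v = does (Arc? (toℕ u) (toℕ v))

  arc-of-edge : ∀ {n} (u v : Fin n) → graph n u v ≡ true → Arc (toℕ u) (toℕ v)
  arc-of-edge u v with Arc? (toℕ u) (toℕ v)
  ... | yes a = λ _ → a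
  ... | no _  = λ ()

  InBlock-irrefl : ∀ r → ¬ InBlock r r
  InBlock-irrefl r (inj₁ (r<r , _)) = <-irrefl refl r<r
  InBlock-irrefl r (inj₂ r+h<r)     = <-irrefl refl (≤-trans (s≤s (m≤m+n r h)) r+h<r)

  InBlock-asym : ∀ r s → InBlock r s → ¬ InBlock s r
  InBlock-asym r s (inj₁ (r<s , _))   (inj₁ (s<r , _))   = <-asym r<s s<r
  InBlock-asym r s (inj₁ (_ , s≤r+h)) (inj₂ r+h<s)       = <⇒≱ r+h<s s≤r+h
  InBlock-asym r s (inj₂ s+h<r)       (inj₁ (_ , r≤s+h)) = <⇒≱ s+h<r r≤s+h
  InBlock-asym r s (inj₂ s+h<r)       (inj₂ r+h<s)       =
    <-asym (≤-trans (s≤s (m≤m+n s h)) s+h<r) (≤-trans (s≤s (m≤m+n r h)) r+h<s)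

  Arc-irrefl : ∀ x → ¬ Arc x x
  Arc-irrefl zero    ()
  Arc-irrefl (suc x) (_ , r) = InBlock-irrefl (x % B) r

  Arc-asym : ∀ x y → Arc x y → ¬ Arc y x
  Arc-asym zero    zero    ()
  Arc-asym zero    (suc y) y<h h≤y           = <⇒≱ y<h h≤y
  Arc-asym (suc x) zero    h≤x x<h           = <⇒≱ x<h h≤x
  Arc-asym (suc x) (suc y) (_ , xy) (_ , yx) = InBlock-asym (x % B) (y % B) xy yx

  oriented : ∀ n → Oriented (graph n)
  oriented n = (λ u → dec-false (Arc? _ _) (Arc-irrefl (toℕ u)))
             , (λ u v e → dec-false (Arc? _ _) (Arc-asym (toℕ u) (toℕ v) (arc-of-edge u v e)))

  V : ℕ → ℕ → ℕ
  V b r = suc (r + b * B)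

  V-+ : ∀ b c j → V b c + j ≡ V b (c + j)
  V-+ b c j = cong suc (xy∙z≈xz∙y c (b * B) j)

  V-mono : ∀ b {c c′} → c ≤ c′ → V b c ≤ V b c′
  V-mono b c≤c′ = s≤s (+-monoˡ-≤ (b * B) c≤c′)

  V-below : ∀ {m b} → b < m → V b B ≤ m * B + 1
  V-below {m} b<m = ≤-trans (s≤s (*-monoˡ-≤ B b<m)) (≤-reflexive (+-comm 1 (m * B)))

  position-V : ∀ b {r} → r < B → (r + b * B) % B ≡ r
  position-V b {r} r<B = trans ([m+kn]%n≡m%n r b B) (m<n⇒m%n≡m r<B)

  block-V : ∀ b {r} → r < B → (r + b * B) / B ≡ b
  block-V b {r} r<B = begin
    (r + b * B) / B          ≡⟨ +-distrib-/ r (b * B) (subst (_< B) (sym sum%) r<B) ⟩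
    r / B + b * B / B        ≡⟨ cong₂ _+_ (m<n⇒m/n≡0 r<B) (m*n/n≡m b B) ⟩
    b                        ∎
    where
      open ≡-Reasoning
      sum% : r % B + b * B % B ≡ r
      sum% = trans (cong₂ _+_ (m<n⇒m%n≡m r<B) (m*n%n≡0 b B)) (+-identityʳ r)

  decompose : ∀ m x → suc x < m * B + 1 → Σ ℕ λ b → Σ ℕ λ r → b < m × r < B × x ≡ r + b * B
  decompose m x sx<n = x / B , x % B , m<n*o⇒m/o<n x<mB , m%n<n x B , m≡m%n+[m/n]*n x B
    where
      x<mB : x < m * B
      x<mB = s≤s⁻¹ (subst (suc x <_) (+-comm (m * B) 1) sx<n)

  arc-inBlock : ∀ b {r s} → r < B → s < B → InBlock r s → Arc (V b r) (V b s)
  arc-inBlock b r<B s<B rs = trans (block-V b r<B) (sym (block-V b s<B))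
                             , subst₂ InBlock (sym (position-V b r<B)) (sym (position-V b s<B)) rs

  arc-fromHub : ∀ b {s} → s < h → Arc 0 (V b s)
  arc-fromHub b s<h = subst (_< h) (sym (position-V b (≤-trans s<h (m≤m+n h h)))) s<h

  arc-toHub : ∀ b {r} → h ≤ r → r < B → Arc (V b r) 0
  arc-toHub b h≤r r<B = subst (h ≤_) (sym (position-V b r<B)) h≤r

  data Half : ℕ → Set where
    lower : ∀ {r} → r < h → Half r
    upper : ∀ {e} → e < h → Half (e + h)

  half : ∀ {r} → r < B → Half r
  half {r} r<B with r <? h
  ... | yes r<h = lower r<h
  ... | no r≮h  = subst Half r∸h+h≡r (upper (+-cancelʳ-< h (r ∸ h) h (subst (_< B) (sym r∸h+h≡r) r<B)))
    where
      r∸h+h≡r : r ∸ h + h ≡ r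
      r∸h+h≡r = m∸n+n≡m (≮⇒≥ r≮h)

  1+m+[t∸m]≡h : ∀ {m} → m ≤ t → 1 + m + (t ∸ m) ≡ h
  1+m+[t∸m]≡h m≤t = cong suc (m+[n∸m]≡n m≤t)

  1+[m+h]+[t∸m]≡B : ∀ {m} → m ≤ t → suc (m + h) + (t ∸ m) ≡ B
  1+[m+h]+[t∸m]≡B {m} m≤t = begin
    suc (m + h + (t ∸ m))   ≡⟨ cong suc (xy∙z≈xz∙y m h (t ∸ m)) ⟩
    suc (m + (t ∸ m) + h)   ≡⟨ cong (λ z → suc (z + h)) (m+[n∸m]≡n m≤t) ⟩
    suc (t + h)             ∎
    where open ≡-Reasoning

  outs ins : ℕ → ℕ → ℕ
  outs x y = bit (does (Arc? x y))
  ins  y x = bit (does (Arc? x y))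

  arc⇒outs : ∀ x y → Arc x y → 1 ≤ outs x y
  arc⇒outs x y a rewrite dec-true (Arc? x y) a = ≤-refl

  arc⇒ins : ∀ x y → Arc x y → 1 ≤ ins y x
  arc⇒ins x y a rewrite dec-true (Arc? x y) a = ≤-refl

  RunIn : (ℕ → ℕ) → ℕ → ℕ → ℕ → Set
  RunIn f b c l = ∀ s → c ≤ s → s < c + l → s < B → 1 ≤ f (V b s)

  outRun : ∀ x b c l → (∀ s → c ≤ s → s < c + l → s < B → Arc x (V b s)) → RunIn (outs x) b c l
  outRun x b c l arcs s c≤s s<c+l s<B = arc⇒outs x (V b s) (arcs s c≤s s<c+l s<B)

  inRun : ∀ y b c l → (∀ s → c ≤ s → s < c + l → s < B → Arc (V b s) y) → RunIn (ins y) b c l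
  inRun y b c l arcs s c≤s s<c+l s<B = arc⇒ins (V b s) y (arcs s c≤s s<c+l s<B)

  block-run : ∀ f b c l → c + l ≤ B → RunIn f b c l → sumBelow (V b c) f + l ≤ sumBelow (V b (c + l)) f
  block-run f b c l c+l≤B run = subst (λ v → sumBelow (V b c) f + l ≤ sumBelow v f) (V-+ b c l)
    (sumBelow-run f (V b c) l λ j j<l → subst (λ v → 1 ≤ f v) (sym (V-+ b c j))
      (run (c + j) (m≤m+n c j) (+-monoʳ-< c j<l) (<-≤-trans (+-monoʳ-< c j<l) c+l≤B)))

  -- Every neighbourhood consists of at most the hub and two intervals of one block.
  hub-and-two-runs : ∀ f m b → b < m → ∀ {k c₁ l₁ c₂ l₂} → k ≤ f 0 → c₁ + l₁ ≤ c₂ → c₂ + l₂ ≤ B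
                   → RunIn f b c₁ l₁ → RunIn f b c₂ l₂ → k + l₁ + l₂ ≤ sumBelow (m * B + 1) f
  hub-and-two-runs f m b b<m {k} {c₁} {l₁} {c₂} {l₂} k≤f0 gap end run₁ run₂ = begin
    k + l₁ + l₂                       ≤⟨ +-monoˡ-≤ l₂ (+-monoˡ-≤ l₁ (≤-trans k≤f0 (sumBelow-mono f (s≤s z≤n)))) ⟩
    sumBelow (V b c₁) f + l₁ + l₂     ≤⟨ +-monoˡ-≤ l₂ (block-run f b c₁ l₁ (≤-trans gap c₂≤B) run₁) ⟩
    sumBelow (V b (c₁ + l₁)) f + l₂   ≤⟨ +-monoˡ-≤ l₂ (sumBelow-mono f (V-mono b gap)) ⟩
    sumBelow (V b c₂) f + l₂          ≤⟨ block-run f b c₂ l₂ end run₂ ⟩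
    sumBelow (V b (c₂ + l₂)) f        ≤⟨ sumBelow-mono f (≤-trans (V-mono b end) (V-below b<m)) ⟩
    sumBelow (m * B + 1) f            ∎
    where
      open ≤-Reasoning
      c₂≤B : c₂ ≤ B
      c₂≤B = ≤-trans (m≤m+n c₂ l₂) end

  outdeg-hub : ∀ m → 0 < m → h ≤ sumBelow (m * B + 1) (outs 0)
  outdeg-hub m 0<m = hub-and-two-runs (outs 0) m 0 0<m {0} {0} {0} {0} {h} z≤n z≤n (m≤m+n h h)
    (λ _ _ ()) (outRun 0 0 0 h λ _ _ s<h _ → arc-fromHub 0 s<h)

  indeg-hub : ∀ m → 0 < m → h ≤ sumBelow (m * B + 1) (ins 0)
  indeg-hub m 0<m = hub-and-two-runs (ins 0) m 0 0<m {0} {0} {0} {h} {h} z≤n z≤n ≤-refl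
    (λ _ _ ()) (inRun 0 0 h h λ _ h≤s _ s<B → arc-toHub 0 h≤s s<B)

  outdeg-V : ∀ m b r → b < m → r < B → h ≤ sumBelow (m * B + 1) (outs (V b r))
  outdeg-V m b r b<m r<B with half r<B
  ... | lower r<h = hub-and-two-runs (outs (V b r)) m b b<m {0} {0} {0} {suc r} {h}
    z≤n z≤n (+-monoˡ-≤ h r<h)
    (λ _ _ ())
    (outRun (V b r) b (suc r) h λ s r<s s≤r+h s<B → arc-inBlock b r<B s<B (inj₁ (r<s , s≤s⁻¹ s≤r+h)))
  ... | upper {e} e<h = subst (_≤ sumBelow (m * B + 1) (outs (V b r))) (1+m+[t∸m]≡h e≤t)
    (hub-and-two-runs (outs (V b r)) m b b<m {1} {0} {e} {suc r} {t ∸ e}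
      (arc⇒outs (V b r) 0 (arc-toHub b (m≤n+m h e) r<B))
      (≤-trans (m≤m+n e h) (n≤1+n r)) (≤-reflexive (1+[m+h]+[t∸m]≡B e≤t))
      (outRun (V b r) b 0 e λ s _ s<e s<B → arc-inBlock b r<B s<B (inj₂ (+-monoˡ-< h s<e)))
      (outRun (V b r) b (suc r) (t ∸ e) λ s r<s _ s<B →
        arc-inBlock b r<B s<B (inj₁ (r<s , ≤-trans (<⇒≤ s<B) (+-monoˡ-≤ h (m≤n+m h e))))))
    where
      e≤t : e ≤ t
      e≤t = s≤s⁻¹ e<h

  indeg-V : ∀ m b s → b < m → s < B → h ≤ sumBelow (m * B + 1) (ins (V b s))
  indeg-V m b s b<m s<B with half s<B
  ... | lower s<h = subst (_≤ sumBelow (m * B + 1) (ins (V b s))) (1+m+[t∸m]≡h s≤t)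
    (hub-and-two-runs (ins (V b s)) m b b<m {1} {0} {s} {suc (s + h)} {t ∸ s}
      (arc⇒ins 0 (V b s) (arc-fromHub b s<h))
      (≤-trans (m≤m+n s h) (n≤1+n _)) (≤-reflexive (1+[m+h]+[t∸m]≡B s≤t))
      (inRun (V b s) b 0 s λ u _ u<s u<B → arc-inBlock b u<B s<B (inj₁ (u<s , ≤-trans (<⇒≤ s<h) (m≤n+m h u))))
      (inRun (V b s) b (suc (s + h)) (t ∸ s) λ u s+h<u _ u<B → arc-inBlock b u<B s<B (inj₂ s+h<u)))
    where
      s≤t : s ≤ t
      s≤t = s≤s⁻¹ s<h
  ... | upper {e} e<h = hub-and-two-runs (ins (V b s)) m b b<m {0} {0} {0} {e} {h}
    z≤n z≤n (+-monoˡ-≤ h (<⇒≤ e<h))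
    (λ _ _ ())
    (inRun (V b s) b e h λ u e≤u u<e+h u<B → arc-inBlock b u<B s<B (inj₁ (u<e+h , +-monoˡ-≤ h e≤u)))

  degrees : ∀ m → 0 < m → ∀ x → x < m * B + 1
          → h ≤ sumBelow (m * B + 1) (outs x) × h ≤ sumBelow (m * B + 1) (ins x)
  degrees m 0<m zero    _     = outdeg-hub m 0<m , indeg-hub m 0<m
  degrees m 0<m (suc x) sx<n with decompose m x sx<n
  ... | b , r , b<m , r<B , refl = outdeg-V m b r b<m r<B , indeg-V m b r b<m r<B

  minSemidegree : ∀ m → 0 < m → MinSemidegreeAtLeast (graph (m * B + 1)) h
  minSemidegree m 0<m v =
      subst (h ≤_) (sym (sum-allFin n (outs (toℕ v)))) (proj₁ δ)
    , subst (h ≤_) (sym (sum-allFin n (ins (toℕ v)))) (proj₂ δ)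
    where
      n = m * B + 1
      δ = degrees m 0<m (toℕ v) (toℕ<n v)

  block : ℕ → ℕ
  block zero    = 0
  block (suc x) = x / B

  slot : ℕ → ℕ
  slot zero    = 0
  slot (suc x) = suc (x % B)

  slot<1+B : ∀ x → slot x < suc B
  slot<1+B zero    = z<s
  slot<1+B (suc x) = s<s (m%n<n x B)

  arc-sameBlock : ∀ {x y} → x ≢ 0 → y ≢ 0 → Arc x y → block x ≡ block y
  arc-sameBlock {zero}          x≢0 _   _          = ⊥-elim (x≢0 refl)
  arc-sameBlock {suc x} {zero}  _   y≢0 _          = ⊥-elim (y≢0 refl)
  arc-sameBlock {suc x} {suc y} _   _   (same , _) = same

  slot-block-injective : ∀ x y → (x ≢ 0 → y ≢ 0 → block x ≡ block y) → slot x ≡ slot y → x ≡ y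
  slot-block-injective zero    zero    _ _ = refl
  slot-block-injective (suc x) (suc y) sameBlock sameSlot = cong suc (begin
    x                  ≡⟨ m≡m%n+[m/n]*n x B ⟩
    x % B + x / B * B  ≡⟨ cong₂ (λ r b → r + b * B) (suc-injective sameSlot) (sameBlock (λ ()) (λ ())) ⟩
    y % B + y / B * B  ≡⟨ sym (m≡m%n+[m/n]*n y B) ⟩
    y                  ∎)
    where open ≡-Reasoning

  module LongCycle {n M : ℕ} (c : DirCycle' (graph n) M) where
    open DirCycle' c

    -- The cycle as a sequence of vertex numbers; the value past M is junk.
    walk : ℕ → ℕ
    walk k with k <? suc M
    ... | yes k<1+M = toℕ (vtx (fromℕ< k<1+M))
    ... | no _      = 0

    walk-at : ∀ i {k} → toℕ i ≡ k → toℕ (vtx i) ≡ walk k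
    walk-at i refl with toℕ i <? suc M
    ... | yes i<1+M = cong (toℕ ∘ vtx) (sym (fromℕ<-toℕ i i<1+M))
    ... | no i≮1+M  = ⊥-elim (i≮1+M (toℕ<n i))

    walk-arc : ∀ k → k < M → Arc (walk k) (walk (suc k))
    walk-arc k k<M = subst₂ Arc
      (walk-at (inject₁ i) (trans (toℕ-inject₁ i) (toℕ-fromℕ< k<M)))
      (walk-at (Fin.suc i) (cong suc (toℕ-fromℕ< k<M)))
      (arc-of-edge _ _ (step i))
      where i = fromℕ< k<M

    walk-close : Arc (walk M) (walk 0)
    walk-close = subst₂ Arc (walk-at (fromℕ M) (toℕ-fromℕ M)) (walk-at Fin.zero refl) (arc-of-edge _ _ close)

    walk-injective : ∀ {k k′} → k ≤ M → k′ ≤ M → walk k ≡ walk k′ → k ≡ k′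
    walk-injective {k} {k′} k≤M k′≤M same = begin
      k          ≡⟨ sym (toℕ-fromℕ< (s≤s k≤M)) ⟩
      toℕ i      ≡⟨ cong toℕ (inj i i′ (toℕ-injective (trans (walk-at i (toℕ-fromℕ< (s≤s k≤M)))
                      (trans same (sym (walk-at i′ (toℕ-fromℕ< (s≤s k′≤M)))))))) ⟩
      toℕ i′     ≡⟨ toℕ-fromℕ< (s≤s k′≤M) ⟩
      k′         ∎
      where
        open ≡-Reasoning
        i  = fromℕ< (s≤s k≤M)
        i′ = fromℕ< (s≤s k′≤M)

    -- If the hub does not occur at all, any index beyond M serves as its position.
    hub : Σ ℕ λ q → ∀ k → k ≤ M → walk k ≡ 0 → k ≡ q
    hub with any? (λ i → walk (toℕ i) ≟ 0)
    ... | yes (i , wi≡0) = toℕ i , λ k k≤M wk≡0 → walk-injective k≤M (s≤s⁻¹ (toℕ<n i)) (trans wk≡0 (sym wi≡0))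
    ... | no noHub       = suc M , λ k k≤M wk≡0 →
      ⊥-elim (noHub (fromℕ< (s≤s k≤M) , trans (cong walk (toℕ-fromℕ< (s≤s k≤M))) wk≡0))

    hub-unique : ∀ k → k ≤ M → walk k ≡ 0 → k ≡ proj₁ hub
    hub-unique = proj₂ hub

    HubFree : ℕ → ℕ → Set
    HubFree a c = ∀ k → a ≤ k → k ≤ c → walk k ≢ 0

    segment : ∀ {a} c → a ≤ c → c ≤ M → HubFree a c → block (walk a) ≡ block (walk c)
    segment {a} c a≤c c≤M free with m≤n⇒m<n∨m≡n a≤c
    ... | inj₂ refl = refl
    segment {a} zero    _ _   _    | inj₁ ()
    segment {a} (suc c) _ c<M free | inj₁ (s≤s a≤c) = trans
      (segment c a≤c (<⇒≤ c<M) (λ k a≤k k≤c → free k a≤k (m≤n⇒m≤1+n k≤c)))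
      (arc-sameBlock (free c a≤c (n≤1+n c)) (free (suc c) (m≤n⇒m≤1+n a≤c) ≤-refl) (walk-arc c c<M))

    -- The hub occurs at most once, so either it lies outside [i, j], or it
    -- lies inside and then the rest of the cycle, from j round to i, avoids it.
    sameBlock≤ : ∀ {i j} → i ≤ j → j ≤ M → walk i ≢ 0 → walk j ≢ 0 → block (walk i) ≡ block (walk j)
    sameBlock≤ {i} {j} i≤j j≤M wi≢0 wj≢0 with proj₁ hub <? i | j <? proj₁ hub
    ... | yes q<i | _ = segment j i≤j j≤M λ k i≤k k≤j wk≡0 →
      <⇒≱ q<i (subst (i ≤_) (hub-unique k (≤-trans k≤j j≤M) wk≡0) i≤k)
    ... | no _ | yes j<q = segment j i≤j j≤M λ k _ k≤j wk≡0 →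
      <⇒≱ j<q (subst (_≤ j) (hub-unique k (≤-trans k≤j j≤M) wk≡0) k≤j)
    ... | no q≮i | no j≮q = trans (sym (segment i z≤n i≤M λ k _ k≤i → outside k (≤-trans k≤i i≤M) (inj₁ k≤i)))
      (trans (sym (arc-sameBlock (outside M ≤-refl (inj₂ j≤M)) (outside 0 z≤n (inj₁ z≤n)) walk-close))
             (sym (segment M j≤M ≤-refl λ k j≤k k≤M → outside k k≤M (inj₂ j≤k))))
      where
        i≤M : i ≤ M
        i≤M = ≤-trans i≤j j≤M
        outside : ∀ k → k ≤ M → k ≤ i ⊎ j ≤ k → walk k ≢ 0
        outside k k≤M (inj₁ k≤i) wk≡0 = wi≢0 (subst (λ z → walk z ≡ 0)
          (≤-antisym k≤i (subst (i ≤_) (sym (hub-unique k k≤M wk≡0)) (≮⇒≥ q≮i))) wk≡0)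
        outside k k≤M (inj₂ j≤k) wk≡0 = wj≢0 (subst (λ z → walk z ≡ 0)
          (≤-antisym (subst (_≤ j) (sym (hub-unique k k≤M wk≡0)) (≮⇒≥ j≮q)) j≤k) wk≡0)

    sameBlock : ∀ {i j} → i ≤ M → j ≤ M → walk i ≢ 0 → walk j ≢ 0 → block (walk i) ≡ block (walk j)
    sameBlock {i} {j} i≤M j≤M wi≢0 wj≢0 with ≤-total i j
    ... | inj₁ i≤j = sameBlock≤ i≤j j≤M wi≢0 wj≢0
    ... | inj₂ j≤i = sym (sameBlock≤ j≤i i≤M wj≢0 wi≢0)

    length≤1+B : B < M → ⊥
    length≤1+B B<M with pigeonhole (s<s B<M) (λ i → fromℕ< (slot<1+B (walk (toℕ i))))
    ... | i , j , i<j , sameSlot = <-irrefl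
      (walk-injective i≤M j≤M (slot-block-injective _ _ (sameBlock i≤M j≤M)
        (fromℕ<-injective _ _ (slot<1+B _) (slot<1+B _) sameSlot)))
      i<j
      where
        i≤M = s≤s⁻¹ (toℕ<n i)
        j≤M = s≤s⁻¹ (toℕ<n j)

  noLongCycle : ∀ n L → suc (suc B) ≤ L → ¬ DirCycle (graph n) L
  noLongCycle n (suc M) (s≤s B<M) c = LongCycle.length≤1+B c B<M

m*2≡m+m : ∀ m → m * 2 ≡ m + m
m*2≡m+m m = trans (*-comm m 2) (cong (m +_) (+-identityʳ m))

even-above-4 : ∀ {ℓ} → 2 ∣ ℓ → 4 < ℓ → ∃ λ u → ℓ ≡ 2 + (suc (suc u) + suc (suc u))
even-above-4 (divides 0 refl) ()
even-above-4 (divides 1 refl) (s≤s (s≤s ()))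
even-above-4 (divides 2 refl) (s≤s (s≤s (s≤s (s≤s ()))))
even-above-4 (divides (suc (suc (suc u))) refl) _ = u , cong (λ z → 2 + z) (m*2≡m+m (suc (suc u)))

floor-bound : ∀ {k} m h (k>0 : 0 < k) → 1 < h → m * 2 ≤ k ∸ 1 → divFloor (m * (h + h) + 1) k k>0 + 1 ≤ h
floor-bound {suc k′} m h k>0 1<h m*2≤k′ =
  subst (_≤ h) (+-comm 1 _) (m<n*o⇒m/o<n {{>-nonZero k>0}} (begin-strict
    m * (h + h) + 1   ≡⟨ cong (_+ 1) (trans (cong (m *_) (cong (h +_) (sym (+-identityʳ h)))) (sym (*-assoc m 2 h))) ⟩
    m * 2 * h + 1     ≤⟨ +-monoˡ-≤ 1 (*-monoˡ-≤ h m*2≤k′) ⟩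
    k′ * h + 1        <⟨ +-monoʳ-< (k′ * h) 1<h ⟩
    k′ * h + h        ≡⟨ trans (+-comm (k′ * h) h) (*-comm (suc k′) h) ⟩
    h * suc k′        ∎))
  where open ≤-Reasoning

proposition2p11 : (ℓ k : ℕ) → 4 < ℓ → 2 ∣ ℓ → (k>2 : 2 < k) → ¬ (k ∣ ℓ)
    → ((j : ℕ) → 2 < j → j < k → j ∣ ℓ)
    → Σ (Digraph (((k ∸ 1) / 2) * (ℓ ∸ 2) + 1)) λ G →
    Oriented G
    × MinSemidegreeAtLeast G (divFloor (((k ∸ 1) / 2) * (ℓ ∸ 2) + 1) k (<-trans z<s k>2) + 1)
    × ((L : ℕ) → ℓ ≤ L → ¬ DirCycle G L)
proposition2p11 ℓ k 4<ℓ 2∣ℓ k>2 _ _ with even-above-4 2∣ℓ 4<ℓ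
... | u , refl =
    graph n
  , oriented n
  , minSemidegree-mono (floor-bound m h (<-trans z<s k>2) (s≤s (s≤s z≤n)) (m/n*n≤m (k ∸ 1) 2))
                       (minSemidegree m (m≥n⇒m/n>0 (∸-monoˡ-≤ 1 k>2)))
  , noLongCycle n
  where
    open HubGluedTournaments (suc u)
    m = (k ∸ 1) / 2
    n = m * B + 1
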